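{- Let $(V,E)$ be an undirected graph with non-negative edge weights, let $s,t\in V$, let $M\subseteq E$ be a set of vulnerable edges and let $k\in\mathbb{Z}_{\geq 0}$. Let $X\subseteq E$ be a feasible solution of the Fault-Tolerant Path instance on $(V,E)$, i.e. for every $F\subseteq M$ with $|F|\leq k$ the graph $(V,X\setminus F)$ contains an $s$-$t$ path. Then there is an orientation $\overrightarrow{X}$ of $X$ such that for every $F\subseteq M$ with $|F|\leq k$, the directed graph obtained from $(V,\overrightarrow{X})$ by deleting the arcs corresponding to the edges of $F$ contains a directed $s$-$t$ path.
   Context: An orientation of a set $X$ of undirected edges is an arc set obtained by replacing each edge $vw\in X$ by exactly one of the arcs $vw$ or $wv$. -}

module Defs where

open import Data.Nat using (ℕ; _≤_)
open import Data.Fin using (Fin)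
open import Data.Fin.Subset using (Subset; _∈_; _∉_; _⊆_; ∣_∣)
open import Data.Bool using (Bool; true; false)
open import Data.Product using (_×_; _,_; Σ; ∃; proj₁; proj₂)
open import Data.Sum using (_⊎_)
open import Data.List using (List; []; _∷_)
open import Data.List.Relation.Unary.Unique.Propositional using (Unique)
open import Relation.Binary.PropositionalEquality using (_≡_)

-- A (multi)graph on vertex set Fin n with edges indexed by Fin m;
-- edge e has endpoints (proj₁ (ends e)) and (proj₂ (ends e)).
record Graph (n m : ℕ) : Set where
  field
    ends : Fin m → Fin n × Fin n

open Graph public

data Walk {n : ℕ} (R : Fin n → Fin n → Set) : Fin n → Fin n → Set where
  [] : ∀ {u} → Walk R u u
  _∷_ : ∀ {u w v} → R u w → Walk R w v → Walk R u v

vertices : ∀ {n} {R : Fin n → Fin n → Set} {u v : Fin n} → Walk R u v → List (Fin n)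
vertices {u = u} [] = u ∷ []
vertices {u = u} (_ ∷ p) = u ∷ vertices p

Path : ∀ {n} → (Fin n → Fin n → Set) → Fin n → Fin n → Set
Path R u v = Σ (Walk R u v) (λ p → Unique (vertices p))

InDiff : ∀ {m} → Subset m → Subset m → Fin m → Set
InDiff Y F e = e ∈ Y × e ∉ F

HasUPath : ∀ {n m} → Graph n m → Subset m → Subset m → Fin n → Fin n → Set
HasUPath G X F s t =
  Path (λ u v → ∃ λ e → InDiff X F e × (ends G e ≡ (u , v) ⊎ ends G e ≡ (v , u))) s t

arc : ∀ {n m} → Graph n m → (Fin m → Bool) → Fin m → Fin n × Fin n
arc G o e with o e
... | true  = ends G e
... | false = proj₂ (ends G e) , proj₁ (ends G e)

HasDPath : ∀ {n m} → Graph n m → (Fin m → Bool) → Subset m → Subset m →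
           Fin n → Fin n → Set
HasDPath G o X F s t =
  Path (λ u v → ∃ λ e → InDiff X F e × arc G o e ≡ (u , v)) s t

Feasible : ∀ {n m} → Graph n m → Subset m → ℕ → Fin n → Fin n → Subset m → Set
Feasible G M k s t X =
  (F : Subset _) → F ⊆ M → ∣ F ∣ ≤ k → HasUPath G X F s t

-- Give the vulnerable edges capacity 1 and the other edges of X unbounded capacity.
-- Augmenting k+1 times along residual s-t paths yields an integral flow g of value k+1:
-- if some round found no residual path, the vertices reachable from s would form a cut
-- crossed only by saturated vulnerable edges, at most k of them, and deleting these would
-- separate s from t, contradicting feasibility. Orient every edge along its flow. If
-- deleting some F ⊆ M with |F| ≤ k left no directed s-t path, the vertices reachable
-- from s would form a cut that flow can only leave along arcs of F, one unit each, so
-- the value k+1 would be at most |F| ≤ k.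

module Submission where

open import Defs
open import Data.Nat using (ℕ; zero; suc; _≤_; _≤?_; z≤n; s≤s)
import Data.Nat.Properties as ℕₚ
open import Data.Integer as ℤ using (ℤ; +_; -[1+_]; 0ℤ; 1ℤ; -1ℤ; _+_; _-_; _*_; -_; +≤+; -≤+)
import Data.Integer.Properties as ℤₚ
open import Data.Integer.Tactic.RingSolver using (solve-∀)
open import Algebra.Properties.CommutativeMonoid.Sum ℤₚ.+-0-commutativeMonoid
  using (sum; sum-cong-≗; sum-replicate-zero)
open import Data.Fin using (Fin; zero; suc)
open import Data.Fin.Properties using (any?; suc-injective) renaming (_≟_ to _≟ᶠ_)
open import Data.Fin.Subset using (Subset; inside; outside; _∈_; _∉_; _⊆_; _⊂_; _∪_; ⁅_⁆; ∣_∣)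
open import Data.Fin.Subset.Properties using (_∈?_; x∈⁅x⁆; x∈⁅y⁆⇒x≡y; p⊆p∪q; x∈p∪q⁺; x∈p∪q⁻)
open import Data.Fin.Subset.Induction using (⊃-wellFounded; Acc; acc)
open import Data.Vec using ([]; _∷_; lookup; tabulate)
open import Data.Vec.Properties using ([]=⇒lookup; lookup⇒[]=; lookup∘tabulate)
open import Data.Vec.Functional using (updateAt)
open import Data.Vec.Functional.Properties using (updateAt-updates; updateAt-minimal)
open import Data.Bool using (Bool; true; false; if_then_else_)
open import Data.Product using (_×_; _,_; Σ; ∃; ∃₂; proj₁; proj₂)
open import Data.Product.Properties using (≡-dec)
open import Data.Sum using (_⊎_; inj₁; inj₂)
open import Data.List.Relation.Unary.Any as Any using (here; there)
open import Data.List.Relation.Unary.All using ([])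
open import Data.List.Relation.Unary.All.Properties.Core using (¬Any⇒All¬; All¬⇒¬Any)
open import Data.List.Relation.Unary.AllPairs using ([]; _∷_)
open import Data.List.Relation.Unary.Unique.Propositional using (Unique)
open import Data.List.Membership.Propositional using () renaming (_∈_ to _∈ᴸ_; _∉_ to _∉ᴸ_)
open import Function using (_∘_; flip; const)
open import Relation.Nullary using (¬_; Dec; yes; no; does; contradiction)
open import Relation.Nullary.Decidable using (_×-dec_; _⊎-dec_; _→-dec_; ¬?; map′; dec-true; dec-false)
open import Relation.Binary.Definitions using (Decidable)
open import Relation.Binary.PropositionalEquality
  using (_≡_; _≢_; refl; sym; trans; cong; cong₂; subst; module ≡-Reasoning)

sum-mono-≤ : ∀ {n} {f h : Fin n → ℤ} → (∀ i → f i ℤ.≤ h i) → sum f ℤ.≤ sum h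
sum-mono-≤ {zero}  _   = ℤₚ.≤-refl
sum-mono-≤ {suc n} f≤h = ℤₚ.+-mono-≤ (f≤h zero) (sum-mono-≤ (f≤h ∘ suc))

sum-differingAt : ∀ {n} (f h : Fin n → ℤ) i → (∀ j → j ≢ i → h j ≡ f j) →
                  sum h ≡ sum f + (h i - f i)
sum-differingAt {suc n} f h zero agree = begin
  h zero + sum (h ∘ suc)                     ≡⟨ cong (λ x → h zero + x) (sum-cong-≗ (λ j → agree (suc j) λ ())) ⟩
  h zero + sum (f ∘ suc)                     ≡⟨ regroup (h zero) (f zero) _ ⟩
  f zero + sum (f ∘ suc) + (h zero - f zero) ∎
  where
  open ≡-Reasoning
  regroup : ∀ a b c → a + c ≡ b + c + (a - b)
  regroup = solve-∀
sum-differingAt {suc n} f h (suc i) agree = begin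
  h zero + sum (h ∘ suc)                             ≡⟨ cong₂ _+_ (agree zero λ ()) (sum-differingAt (f ∘ suc) (h ∘ suc) i
                                                          (λ j j≢i → agree (suc j) (j≢i ∘ suc-injective))) ⟩
  f zero + (sum (f ∘ suc) + (h (suc i) - f (suc i))) ≡⟨ ℤₚ.+-assoc (f zero) _ _ ⟨
  f zero + sum (f ∘ suc) + (h (suc i) - f (suc i))   ∎
  where open ≡-Reasoning

∣i∣≤1⇒i≤1 : ∀ {i} → ℤ.∣ i ∣ ≤ 1 → i ℤ.≤ 1ℤ
∣i∣≤1⇒i≤1 {+ _}      ∣i∣≤1 = +≤+ ∣i∣≤1
∣i∣≤1⇒i≤1 { -[1+ _ ]} _    = -≤+

∣i∣≤1⇒-i≤1 : ∀ {i} → ℤ.∣ i ∣ ≤ 1 → - i ℤ.≤ 1ℤ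
∣i∣≤1⇒-i≤1 {i} ∣i∣≤1 = ∣i∣≤1⇒i≤1 (subst (_≤ 1) (sym (ℤₚ.∣-i∣≡∣i∣ i)) ∣i∣≤1)

∣i∣≤1∧∣i+1∣≰1⇒i≡1 : ∀ {i} → ℤ.∣ i ∣ ≤ 1 → ¬ ℤ.∣ i + 1ℤ ∣ ≤ 1 → i ≡ 1ℤ
∣i∣≤1∧∣i+1∣≰1⇒i≡1 {+ 0}           _         ∣i+1∣≰1 = contradiction ℕₚ.≤-refl ∣i+1∣≰1
∣i∣≤1∧∣i+1∣≰1⇒i≡1 {+ 1}           _         _       = refl
∣i∣≤1∧∣i+1∣≰1⇒i≡1 {+ suc (suc _)} (s≤s ()) _
∣i∣≤1∧∣i+1∣≰1⇒i≡1 { -[1+ 0 ]}     _         ∣i+1∣≰1 = contradiction z≤n ∣i+1∣≰1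
∣i∣≤1∧∣i+1∣≰1⇒i≡1 { -[1+ suc _ ]} (s≤s ()) _

∣i∣≤1∧∣i-1∣≰1⇒i≡-1 : ∀ {i} → ℤ.∣ i ∣ ≤ 1 → ¬ ℤ.∣ i + -1ℤ ∣ ≤ 1 → i ≡ -1ℤ
∣i∣≤1∧∣i-1∣≰1⇒i≡-1 {+ 0}           _         ∣i-1∣≰1 = contradiction ℕₚ.≤-refl ∣i-1∣≰1
∣i∣≤1∧∣i-1∣≰1⇒i≡-1 {+ 1}           _         ∣i-1∣≰1 = contradiction z≤n ∣i-1∣≰1
∣i∣≤1∧∣i-1∣≰1⇒i≡-1 {+ suc (suc _)} (s≤s ()) _
∣i∣≤1∧∣i-1∣≰1⇒i≡-1 { -[1+ 0 ]}     _         _       = refl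
∣i∣≤1∧∣i-1∣≰1⇒i≡-1 { -[1+ suc _ ]} (s≤s ()) _

χ : ∀ {n} → Subset n → Fin n → ℤ
χ p x = if lookup p x then 1ℤ else 0ℤ

χ-∈ : ∀ {n} {p : Subset n} {x} → x ∈ p → χ p x ≡ 1ℤ
χ-∈ x∈p rewrite []=⇒lookup x∈p = refl

χ-∉ : ∀ {n} {p : Subset n} {x} → x ∉ p → χ p x ≡ 0ℤ
χ-∉ {p = p} {x} x∉p with lookup p x in eq
... | true  = contradiction (lookup⇒[]= x p eq) x∉p
... | false = refl

χ-nonneg : ∀ {n} (p : Subset n) x → 0ℤ ℤ.≤ χ p x
χ-nonneg p x with lookup p x
... | true  = +≤+ z≤n
... | false = +≤+ z≤n

sum-χ : ∀ {n} (p : Subset n) → sum (χ p) ≡ + ∣ p ∣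
sum-χ []            = refl
sum-χ (inside  ∷ p) = cong (λ x → 1ℤ + x) (sum-χ p)
sum-χ (outside ∷ p) = trans (ℤₚ.+-identityˡ _) (sum-χ p)

subset : ∀ {n} {P : Fin n → Set} → (∀ x → Dec (P x)) → Subset n
subset P? = tabulate (does ∘ P?)

∈-subset⁺ : ∀ {n} {P : Fin n → Set} (P? : ∀ x → Dec (P x)) {x} → P x → x ∈ subset P?
∈-subset⁺ P? {x} px = lookup⇒[]= x _ (trans (lookup∘tabulate _ x) (dec-true (P? x) px))

∈-subset⁻ : ∀ {n} {P : Fin n → Set} (P? : ∀ x → Dec (P x)) {x} → x ∈ subset P? → P x
∈-subset⁻ P? {x} x∈ with P? x | trans (sym (lookup∘tabulate (does ∘ P?) x)) ([]=⇒lookup x∈)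
... | yes px | _ = px
... | no _   | ()

Closed : ∀ {n} → (Fin n → Fin n → Set) → Subset n → Set
Closed R S = ∀ {x y} → x ∈ S → y ∉ S → ¬ R x y

Cut : ∀ {n} → (Fin n → Fin n → Set) → Fin n → Fin n → Set
Cut {n} R s t = Σ (Subset n) λ S → s ∈ S × t ∉ S × Closed R S

module _ {n} {R : Fin n → Fin n → Set} where

  _▷_ : ∀ {u v w} → Walk R u v → R v w → Walk R u w
  []      ▷ r = r ∷ []
  (q ∷ p) ▷ r = q ∷ (p ▷ r)

  source∈vertices : ∀ {u v} (p : Walk R u v) → u ∈ᴸ vertices p
  source∈vertices []      = here refl
  source∈vertices (_ ∷ _) = here refl

  suffixFrom : ∀ {u w v} (p : Walk R w v) → Unique (vertices p) → u ∈ᴸ vertices p → Path R u v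
  suffixFrom []      uniq         (here refl) = [] , uniq
  suffixFrom (r ∷ p) uniq         (here refl) = r ∷ p , uniq
  suffixFrom (r ∷ p) (_ ∷ uniq)   (there u∈p) = suffixFrom p uniq u∈p

  toPath : ∀ {u v} → Walk R u v → Path R u v
  toPath [] = [] , [] ∷ []
  toPath {u} (r ∷ p) with toPath p
  ... | q , uniq with Any.any? (u ≟ᶠ_) (vertices q)
  ...   | yes u∈q = suffixFrom q uniq u∈q
  ...   | no  u∉q = r ∷ q , ¬Any⇒All¬ _ u∉q ∷ uniq

  walk-leaves : ∀ (S : Subset n) {u v} → Walk R u v → u ∈ S → v ∉ S →
                ∃₂ λ x y → x ∈ S × y ∉ S × R x y
  walk-leaves S []                u∈S u∉S = contradiction u∈S u∉S
  walk-leaves S (_∷_ {w = w} r p) u∈S v∉S with w ∈? S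
  ... | yes w∈S = walk-leaves S p w∈S v∉S
  ... | no  w∉S = _ , _ , u∈S , w∉S , r

  path-or-cut : Decidable R → ∀ s t → Path R s t ⊎ Cut R s t
  path-or-cut R? s t = grow ⁅ s ⁆ (⊃-wellFounded _) (x∈⁅x⁆ s) walk-⁅s⁆
    where
    walk-⁅s⁆ : ∀ {x} → x ∈ ⁅ s ⁆ → Walk R s x
    walk-⁅s⁆ x∈⁅s⁆ with refl ← x∈⁅y⁆⇒x≡y s x∈⁅s⁆ = []

    grow : ∀ S → Acc _ S → s ∈ S → (∀ {x} → x ∈ S → Walk R s x) → Path R s t ⊎ Cut R s t
    grow S (acc larger) s∈S walk with t ∈? S
    ... | yes t∈S = inj₁ (toPath (walk t∈S))
    ... | no  t∉S with any? (λ x → any? λ y → x ∈? S ×-dec ¬? (y ∈? S) ×-dec R? x y)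
    ...   | no  ¬exit = inj₂ (S , s∈S , t∉S , λ x∈S y∉S r → ¬exit (_ , _ , x∈S , y∉S , r))
    ...   | yes (x , y , x∈S , y∉S , r) =
            grow (S ∪ ⁅ y ⁆) (larger S⊂S∪⁅y⁆) (p⊆p∪q _ s∈S) walk′
      where
      S⊂S∪⁅y⁆ : S ⊂ S ∪ ⁅ y ⁆
      S⊂S∪⁅y⁆ = p⊆p∪q _ , y , x∈p∪q⁺ (inj₂ (x∈⁅x⁆ y)) , y∉S

      walk′ : ∀ {z} → z ∈ S ∪ ⁅ y ⁆ → Walk R s z
      walk′ z∈ with x∈p∪q⁻ S ⁅ y ⁆ z∈
      ... | inj₁ z∈S  = walk z∈S
      ... | inj₂ z∈⁅y⁆ with refl ← x∈⁅y⁆⇒x≡y y z∈⁅y⁆ = walk x∈S ▷ r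

module FlowNetwork {n m} (G : Graph n m) (M X : Subset m) (s t : Fin n) where

  from to : Fin m → Fin n
  from e = proj₁ (ends G e)
  to   e = proj₂ (ends G e)

  Crosses SameSide : Subset n → Fin m → Set
  Crosses  S e = (from e ∈ S × to e ∉ S) ⊎ (from e ∉ S × to e ∈ S)
  SameSide S e = (from e ∈ S × to e ∈ S) ⊎ (from e ∉ S × to e ∉ S)

  data Position (S : Subset n) (e : Fin m) : Set where
    leaving  : from e ∈ S → to e ∉ S → Position S e
    entering : from e ∉ S → to e ∈ S → Position S e
    within   : SameSide S e → Position S e

  position : ∀ S e → Position S e
  position S e with from e ∈? S | to e ∈? S
  ... | yes a∈S | yes b∈S = within (inj₁ (a∈S , b∈S))
  ... | yes a∈S | no  b∉S = leaving a∈S b∉S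
  ... | no  a∉S | yes b∈S = entering a∉S b∈S
  ... | no  a∉S | no  b∉S = within (inj₂ (a∉S , b∉S))

  sameSide⇒¬crosses : ∀ {S e} → SameSide S e → ¬ Crosses S e
  sameSide⇒¬crosses (inj₁ (_   , b∈S)) (inj₁ (_   , b∉S)) = b∉S b∈S
  sameSide⇒¬crosses (inj₁ (a∈S , _))   (inj₂ (a∉S , _))   = a∉S a∈S
  sameSide⇒¬crosses (inj₂ (a∉S , _))   (inj₁ (a∈S , _))   = a∉S a∈S
  sameSide⇒¬crosses (inj₂ (_   , b∉S)) (inj₂ (_   , b∈S)) = b∉S b∈S

  crosses? : ∀ S e → Dec (Crosses S e)
  crosses? S e with position S e
  ... | leaving  a∈S b∉S = yes (inj₁ (a∈S , b∉S))
  ... | entering a∉S b∈S = yes (inj₂ (a∉S , b∈S))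
  ... | within   same    = no (sameSide⇒¬crosses same)

  cutEdge? : ∀ S e → Dec (e ∈ X × Crosses S e)
  cutEdge? S e = e ∈? X ×-dec crosses? S e

  cutEdges : Subset n → Subset m
  cutEdges S = subset (cutEdge? S)

  crossing : Subset n → Fin m → ℤ
  crossing S e = χ S (from e) - χ S (to e)

  crossing-leaving : ∀ {S e} → from e ∈ S → to e ∉ S → crossing S e ≡ 1ℤ
  crossing-leaving a∈S b∉S rewrite χ-∈ a∈S | χ-∉ b∉S = refl

  crossing-entering : ∀ {S e} → from e ∉ S → to e ∈ S → crossing S e ≡ -1ℤ
  crossing-entering a∉S b∈S rewrite χ-∉ a∉S | χ-∈ b∈S = refl

  crossing-sameSide : ∀ {S e} → SameSide S e → crossing S e ≡ 0ℤ
  crossing-sameSide (inj₁ (a∈S , b∈S)) rewrite χ-∈ a∈S | χ-∈ b∈S = refl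
  crossing-sameSide (inj₂ (a∉S , b∉S)) rewrite χ-∉ a∉S | χ-∉ b∉S = refl

  Flow : Set
  Flow = Fin m → ℤ

  net : Subset n → Flow → ℤ
  net S g = sum λ e → crossing S e * g e

  -- Conservation and value j at once: the net flow out of every vertex set S.
  HasValue : Flow → ℕ → Set
  HasValue g j = ∀ S → net S g ≡ (χ S s - χ S t) * + j

  Admissible : Flow → Set
  Admissible g = (∀ {e} → e ∉ X → g e ≡ 0ℤ) × (∀ {e} → e ∈ M → ℤ.∣ g e ∣ ≤ 1)

  HasRoom : Flow → Fin m → ℤ → Set
  HasRoom g e d = e ∈ M → ℤ.∣ g e + d ∣ ≤ 1

  data Residual (g : Flow) : Fin n → Fin n → Set where
    forward  : ∀ {e} → e ∈ X → HasRoom g e 1ℤ  → Residual g (from e) (to e)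
    backward : ∀ {e} → e ∈ X → HasRoom g e -1ℤ → Residual g (to e) (from e)

  residual? : ∀ g → Decidable (Residual g)
  residual? g u v = map′ toResidual fromResidual (any? λ e → along? e ⊎-dec against? e)
    where
    Along Against : Fin m → Set
    Along   e = from e ≡ u × to e ≡ v × e ∈ X × HasRoom g e 1ℤ
    Against e = to e ≡ u × from e ≡ v × e ∈ X × HasRoom g e -1ℤ

    hasRoom? : ∀ e d → Dec (HasRoom g e d)
    hasRoom? e d = e ∈? M →-dec ℤ.∣ g e + d ∣ ≤? 1

    along?   : ∀ e → Dec (Along e)
    against? : ∀ e → Dec (Against e)
    along?   e = from e ≟ᶠ u ×-dec to e ≟ᶠ v ×-dec e ∈? X ×-dec hasRoom? e 1ℤ
    against? e = to e ≟ᶠ u ×-dec from e ≟ᶠ v ×-dec e ∈? X ×-dec hasRoom? e -1ℤ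

    toResidual : ∃ (λ e → Along e ⊎ Against e) → Residual g u v
    toResidual (_ , inj₁ (refl , refl , e∈X , room)) = forward e∈X room
    toResidual (_ , inj₂ (refl , refl , e∈X , room)) = backward e∈X room

    fromResidual : Residual g u v → ∃ (λ e → Along e ⊎ Against e)
    fromResidual (forward  e∈X room) = _ , inj₁ (refl , refl , e∈X , room)
    fromResidual (backward e∈X room) = _ , inj₂ (refl , refl , e∈X , room)

  module _ {g : Flow} where

    edge : ∀ {u v} → Residual g u v → Fin m
    edge (forward  {e} _ _) = e
    edge (backward {e} _ _) = e

    direction : ∀ {u v} → Residual g u v → ℤ
    direction (forward  _ _) = 1ℤ
    direction (backward _ _) = -1ℤ

    edge∈X : ∀ {u v} (r : Residual g u v) → edge r ∈ X
    edge∈X (forward  e∈X _) = e∈X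
    edge∈X (backward e∈X _) = e∈X

    edge-hasRoom : ∀ {u v} (r : Residual g u v) → HasRoom g (edge r) (direction r)
    edge-hasRoom (forward  _ room) = room
    edge-hasRoom (backward _ room) = room

    source-endpoint : ∀ {u v} (r : Residual g u v) → u ≡ from (edge r) ⊎ u ≡ to (edge r)
    source-endpoint (forward  _ _) = inj₁ refl
    source-endpoint (backward _ _) = inj₂ refl

    endpoint∈vertices : ∀ {u w v x} (r : Residual g u w) (p : Walk (Residual g) w v) →
                        x ≡ from (edge r) ⊎ x ≡ to (edge r) → x ∈ᴸ vertices (r ∷ p)
    endpoint∈vertices (forward  _ _) p (inj₁ refl) = here refl
    endpoint∈vertices (forward  _ _) p (inj₂ refl) = there (source∈vertices p)
    endpoint∈vertices (backward _ _) p (inj₁ refl) = there (source∈vertices p)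
    endpoint∈vertices (backward _ _) p (inj₂ refl) = here refl

    push : Flow → ∀ {u v} → Residual g u v → Flow
    push h r = updateAt h (edge r) (λ x → x + direction r)

    augment : ∀ {u v} → Walk (Residual g) u v → Flow
    augment []      = g
    augment (r ∷ p) = push (augment p) r

    augment-offPath : ∀ {v w x e} (p : Walk (Residual g) v w) → x ≡ from e ⊎ x ≡ to e →
                      x ∉ᴸ vertices p → augment p e ≡ g e
    augment-offPath []                 _   _   = refl
    augment-offPath {e = e} (r ∷ p) x∼e x∉rp with e ≟ᶠ edge r
    ... | yes refl = contradiction (endpoint∈vertices r p x∼e) x∉rp
    ... | no  e≢r  = trans (updateAt-minimal _ _ (augment p) e≢r) (augment-offPath p x∼e (x∉rp ∘ there))

    -- On a path the edge of each step is used only once.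
    augment-admissible : Admissible g → ∀ {u v} (p : Walk (Residual g) u v) →
                         Unique (vertices p) → Admissible (augment p)
    augment-admissible adm []      _             = adm
    augment-admissible adm (r ∷ p) (u∉p ∷ uniq) = zero-off-X , bounded-on-M
      where
      h : Flow
      h = augment p

      IH : Admissible h
      IH = augment-admissible adm p uniq

      untouched : h (edge r) ≡ g (edge r)
      untouched = augment-offPath p (source-endpoint r) (All¬⇒¬Any u∉p)

      zero-off-X : ∀ {e} → e ∉ X → push h r e ≡ 0ℤ
      zero-off-X {e} e∉X with e ≟ᶠ edge r
      ... | yes refl = contradiction (edge∈X r) e∉X
      ... | no  e≢r  = trans (updateAt-minimal _ _ h e≢r) (proj₁ IH e∉X)

      bounded-on-M : ∀ {e} → e ∈ M → ℤ.∣ push h r e ∣ ≤ 1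
      bounded-on-M {e} e∈M with e ≟ᶠ edge r
      ... | yes refl rewrite updateAt-updates (edge r) {λ x → x + direction r} h | untouched =
            edge-hasRoom r e∈M
      ... | no  e≢r  rewrite updateAt-minimal _ _ {λ x → x + direction r} h e≢r = proj₂ IH e∈M

    push-net : ∀ h {u v} (r : Residual g u v) S → net S (push h r) ≡ net S h + (χ S u - χ S v)
    push-net h r S = trans
      (sum-differingAt _ _ (edge r) λ e e≢r → cong (crossing S e *_) (updateAt-minimal _ _ h e≢r))
      (cong (λ x → net S h + x) (change r))
      where
      change : ∀ {u v} (r : Residual g u v) →
               crossing S (edge r) * push h r (edge r) - crossing S (edge r) * h (edge r) ≡ χ S u - χ S v
      change r@(forward  _ _) rewrite updateAt-updates (edge r) {λ x → x + 1ℤ} h =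
        forward-change (χ S (from (edge r))) (χ S (to (edge r))) (h (edge r))
        where
        forward-change : ∀ a b x → (a - b) * (x + 1ℤ) - (a - b) * x ≡ a - b
        forward-change = solve-∀
      change r@(backward _ _) rewrite updateAt-updates (edge r) {λ x → x + -1ℤ} h =
        backward-change (χ S (from (edge r))) (χ S (to (edge r))) (h (edge r))
        where
        backward-change : ∀ a b x → (a - b) * (x + -1ℤ) - (a - b) * x ≡ b - a
        backward-change = solve-∀

    augment-net : ∀ {u v} (p : Walk (Residual g) u v) S → net S (augment p) ≡ net S g + (χ S u - χ S v)
    augment-net {u} []  S = sym (trans (cong (λ x → net S g + x) (ℤₚ.+-inverseʳ (χ S u))) (ℤₚ.+-identityʳ _))
    augment-net {u} {v} (_∷_ {w = w} r p) S = begin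
      net S (push (augment p) r)                  ≡⟨ push-net (augment p) r S ⟩
      net S (augment p) + (χ S u - χ S w)         ≡⟨ cong (λ x → x + (χ S u - χ S w)) (augment-net p S) ⟩
      net S g + (χ S w - χ S v) + (χ S u - χ S w) ≡⟨ telescope (net S g) (χ S u) (χ S w) (χ S v) ⟩
      net S g + (χ S u - χ S v)                   ∎
      where
      open ≡-Reasoning
      telescope : ∀ a x y z → a + (y - z) + (x - y) ≡ a + (x - z)
      telescope = solve-∀

    augment-increments : ∀ {j} → HasValue g j → (p : Walk (Residual g) s t) → HasValue (augment p) (suc j)
    augment-increments {j} val p S = begin
      net S (augment p)                   ≡⟨ augment-net p S ⟩
      net S g + (χ S s - χ S t)           ≡⟨ cong (λ x → x + (χ S s - χ S t)) (val S) ⟩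
      (χ S s - χ S t) * + j + (χ S s - χ S t) ≡⟨ add-one (χ S s - χ S t) (+ j) ⟩
      (χ S s - χ S t) * + suc j           ∎
      where
      open ≡-Reasoning
      add-one : ∀ a x → a * x + a ≡ a * (1ℤ + x)
      add-one = solve-∀

  zero-flow : Admissible (λ _ → 0ℤ) × HasValue (λ _ → 0ℤ) 0
  zero-flow = ((λ _ → refl) , (λ _ → z≤n)) , λ S → begin
    net S (λ _ → 0ℤ)      ≡⟨ sum-cong-≗ (λ e → ℤₚ.*-zeroʳ (crossing S e)) ⟩
    sum {m} (λ _ → 0ℤ)    ≡⟨ sum-replicate-zero m ⟩
    0ℤ                    ≡⟨ ℤₚ.*-zeroʳ (χ S s - χ S t) ⟨
    (χ S s - χ S t) * + 0 ∎
    where open ≡-Reasoning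

  value-across : ∀ {g j S} → HasValue g j → s ∈ S → t ∉ S → net S g ≡ + j
  value-across {j = j} {S} val s∈S t∉S with val S
  ... | net≡ rewrite χ-∈ s∈S | χ-∉ t∉S = trans net≡ (ℤₚ.*-identityˡ (+ j))

  module _ {g : Flow} (adm : Admissible g) {S : Subset n} (closed : Closed (Residual g) S) where

    saturated-leaving : ∀ {e} → e ∈ X → from e ∈ S → to e ∉ S → e ∈ M × g e ≡ 1ℤ
    saturated-leaving {e} e∈X a∈S b∉S with e ∈? M
    ... | no  e∉M = contradiction (forward e∈X (flip contradiction e∉M)) (closed a∈S b∉S)
    ... | yes e∈M = e∈M , ∣i∣≤1∧∣i+1∣≰1⇒i≡1 (proj₂ adm e∈M) (closed a∈S b∉S ∘ forward e∈X ∘ const)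

    saturated-entering : ∀ {e} → e ∈ X → from e ∉ S → to e ∈ S → e ∈ M × g e ≡ -1ℤ
    saturated-entering {e} e∈X a∉S b∈S with e ∈? M
    ... | no  e∉M = contradiction (backward e∈X (flip contradiction e∉M)) (closed b∈S a∉S)
    ... | yes e∈M = e∈M , ∣i∣≤1∧∣i-1∣≰1⇒i≡-1 (proj₂ adm e∈M) (closed b∈S a∉S ∘ backward e∈X ∘ const)

    cutEdges⊆M : cutEdges S ⊆ M
    cutEdges⊆M e∈F with ∈-subset⁻ (cutEdge? S) e∈F
    ... | e∈X , inj₁ (a∈S , b∉S) = proj₁ (saturated-leaving  e∈X a∈S b∉S)
    ... | e∈X , inj₂ (a∉S , b∈S) = proj₁ (saturated-entering e∈X a∉S b∈S)

    flow-saturates-cutEdges : ∀ e → crossing S e * g e ≡ χ (cutEdges S) e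
    flow-saturates-cutEdges e with e ∈? X
    ... | no e∉X = begin
      crossing S e * g e   ≡⟨ cong (crossing S e *_) (proj₁ adm e∉X) ⟩
      crossing S e * 0ℤ    ≡⟨ ℤₚ.*-zeroʳ (crossing S e) ⟩
      0ℤ                   ≡⟨ χ-∉ (e∉X ∘ proj₁ ∘ ∈-subset⁻ (cutEdge? S)) ⟨
      χ (cutEdges S) e     ∎
      where open ≡-Reasoning
    ... | yes e∈X with position S e
    ...   | leaving a∈S b∉S =
            trans (cong₂ _*_ (crossing-leaving a∈S b∉S) (proj₂ (saturated-leaving e∈X a∈S b∉S)))
                  (sym (χ-∈ (∈-subset⁺ (cutEdge? S) (e∈X , inj₁ (a∈S , b∉S)))))
    ...   | entering a∉S b∈S =
            trans (cong₂ _*_ (crossing-entering a∉S b∈S) (proj₂ (saturated-entering e∈X a∉S b∈S)))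
                  (sym (χ-∈ (∈-subset⁺ (cutEdge? S) (e∈X , inj₂ (a∉S , b∈S)))))
    ...   | within same =
            trans (cong (_* g e) (crossing-sameSide same))
                  (sym (χ-∉ (sameSide⇒¬crosses same ∘ proj₂ ∘ ∈-subset⁻ (cutEdge? S))))

    ∣cutEdges∣≡value : ∀ {j} → HasValue g j → s ∈ S → t ∉ S → ∣ cutEdges S ∣ ≡ j
    ∣cutEdges∣≡value {j} val s∈S t∉S = ℤₚ.+-injective (begin
      + ∣ cutEdges S ∣        ≡⟨ sum-χ (cutEdges S) ⟨
      sum (χ (cutEdges S))    ≡⟨ sum-cong-≗ flow-saturates-cutEdges ⟨
      net S g                 ≡⟨ value-across val s∈S t∉S ⟩
      + j                     ∎)
      where open ≡-Reasoning

    cutEdges-separate : s ∈ S → t ∉ S → ¬ HasUPath G X (cutEdges S) s t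
    cutEdges-separate s∈S t∉S (walk , _) with walk-leaves S walk s∈S t∉S
    ... | x , y , x∈S , y∉S , e , (e∈X , e∉F) , ends≡ = e∉F (∈-subset⁺ (cutEdge? S) (e∈X , crosses ends≡))
      where
      crosses : ends G e ≡ (x , y) ⊎ ends G e ≡ (y , x) → Crosses S e
      crosses (inj₁ refl) = inj₁ (x∈S , y∉S)
      crosses (inj₂ refl) = inj₂ (y∉S , x∈S)

  flow-of-value : ∀ {k} → Feasible G M k s t X → ∀ j → j ≤ suc k →
                  Σ Flow λ g → Admissible g × HasValue g j
  flow-of-value feas zero    _      = _ , zero-flow
  flow-of-value {k} feas (suc j) j<suck with flow-of-value feas j (ℕₚ.<⇒≤ j<suck)
  ... | g , adm , val with path-or-cut (residual? g) s t
  ...   | inj₁ (p , uniq) = augment p , augment-admissible adm p uniq , augment-increments val p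
  ...   | inj₂ (S , s∈S , t∉S , closed) = contradiction
            (feas (cutEdges S) (cutEdges⊆M adm closed) ∣F∣≤k)
            (cutEdges-separate adm closed s∈S t∉S)
    where
    ∣F∣≤k : ∣ cutEdges S ∣ ≤ k
    ∣F∣≤k = subst (_≤ _) (sym (∣cutEdges∣≡value adm closed val s∈S t∉S)) (ℕₚ.≤-pred j<suck)

  orientation : Flow → Fin m → Bool
  orientation g e = does (0ℤ ℤ.≤? g e)

  Arc : (Fin m → Bool) → Subset m → Fin n → Fin n → Set
  Arc o F u v = ∃ λ e → InDiff X F e × arc G o e ≡ (u , v)

  arc? : ∀ o F → Decidable (Arc o F)
  arc? o F u v = any? λ e → (e ∈? X ×-dec ¬? (e ∈? F)) ×-dec ≡-dec _≟ᶠ_ _≟ᶠ_ (arc G o e) (u , v)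

  module _ {g : Flow} (adm : Admissible g) {F : Subset m} (F⊆M : F ⊆ M)
           {S : Subset n} (closed : Closed (Arc (orientation g) F) S) where

    arc-forward : ∀ {e} → 0ℤ ℤ.≤ g e → arc G (orientation g) e ≡ (from e , to e)
    arc-forward {e} 0≤g rewrite dec-true (0ℤ ℤ.≤? g e) 0≤g = refl

    arc-backward : ∀ {e} → ¬ 0ℤ ℤ.≤ g e → arc G (orientation g) e ≡ (to e , from e)
    arc-backward {e} 0≰g rewrite dec-false (0ℤ ℤ.≤? g e) 0≰g = refl

    leaving-arc∈F : ∀ {e x y} → e ∈ X → arc G (orientation g) e ≡ (x , y) → x ∈ S → y ∉ S → e ∈ F
    leaving-arc∈F {e} e∈X arc≡ x∈S y∉S with e ∈? F
    ... | yes e∈F = e∈F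
    ... | no  e∉F = contradiction (e , (e∈X , e∉F) , arc≡) (closed x∈S y∉S)

    flow-across-oriented-cut : ∀ e → crossing S e * g e ℤ.≤ χ F e
    flow-across-oriented-cut e with e ∈? X
    ... | no e∉X rewrite proj₁ adm e∉X | ℤₚ.*-zeroʳ (crossing S e) = χ-nonneg F e
    ... | yes e∈X with position S e
    ...   | within same rewrite crossing-sameSide same = χ-nonneg F e
    ...   | leaving a∈S b∉S rewrite crossing-leaving a∈S b∉S | ℤₚ.*-identityˡ (g e) with 0ℤ ℤ.≤? g e
    ...     | no  0≰g = ℤₚ.≤-trans (ℤₚ.<⇒≤ (ℤₚ.≰⇒> 0≰g)) (χ-nonneg F e)
    ...     | yes 0≤g = ℤₚ.≤-trans (∣i∣≤1⇒i≤1 (proj₂ adm (F⊆M e∈F))) (ℤₚ.≤-reflexive (sym (χ-∈ e∈F)))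
      where
      e∈F : e ∈ F
      e∈F = leaving-arc∈F e∈X (arc-forward 0≤g) a∈S b∉S
    flow-across-oriented-cut e | yes e∈X | entering a∉S b∈S
      rewrite crossing-entering a∉S b∈S | ℤₚ.-1*i≡-i (g e) with 0ℤ ℤ.≤? g e
    ...     | yes 0≤g = ℤₚ.≤-trans (ℤₚ.neg-mono-≤ 0≤g) (χ-nonneg F e)
    ...     | no  0≰g = ℤₚ.≤-trans (∣i∣≤1⇒-i≤1 (proj₂ adm (F⊆M e∈F))) (ℤₚ.≤-reflexive (sym (χ-∈ e∈F)))
      where
      e∈F : e ∈ F
      e∈F = leaving-arc∈F e∈X (arc-backward 0≰g) b∈S a∉S

    net-≤-∣F∣ : net S g ℤ.≤ + ∣ F ∣
    net-≤-∣F∣ = ℤₚ.≤-trans (sum-mono-≤ flow-across-oriented-cut) (ℤₚ.≤-reflexive (sum-χ F))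

  orientation-survives : ∀ {g k} → Admissible g → HasValue g (suc k) →
                         ∀ {F} → F ⊆ M → ∣ F ∣ ≤ k → HasDPath G (orientation g) X F s t
  orientation-survives {g} {k} adm val {F} F⊆M ∣F∣≤k with path-or-cut (arc? (orientation g) F) s t
  ... | inj₁ path = path
  ... | inj₂ (S , s∈S , t∉S , closed) = contradiction ∣F∣≥suck (ℕₚ.≤⇒≯ ∣F∣≤k)
    where
    ∣F∣≥suck : suc k ≤ ∣ F ∣
    ∣F∣≥suck = ℤₚ.drop‿+≤+ (subst (ℤ._≤ + ∣ F ∣) (value-across val s∈S t∉S) (net-≤-∣F∣ adm F⊆M closed))

proposition1 : (n m : ℕ) (G : Graph n m) (w : Fin m → ℕ) (s t : Fin n)
    (M : Subset m) (k : ℕ) (X : Subset m) →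
    Feasible G M k s t X →
    ∃ λ (o : Fin m → Bool) →
    (F : Subset m) → F ⊆ M → ∣ F ∣ ≤ k → HasDPath G o X F s t
proposition1 n m G _ s t M k X feasible =
  let open FlowNetwork G M X s t
      g , admissible , value = flow-of-value feasible (suc k) ℕₚ.≤-refl
  in orientation g , λ F F⊆M ∣F∣≤k → orientation-survives admissible value F⊆M ∣F∣≤k
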